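{- Let $m_1,\dots,m_d$ be positive integers and let $\mathrm{flat}:[0,\infty)^{m_1}\times\cdots\times[0,\infty)^{m_d}\to[0,\infty)^{m_1+\cdots+m_d}$ be concatenation. Then for all $(r_1,\dots,r_d),(r'_1,\dots,r'_d)$ in the domain, \[ (r_1,\dots,r_d)\succ^{(2)}(r'_1,\dots,r'_d)\iff \mathrm{flat}(r_1,\dots,r_d)\succ\mathrm{flat}(r'_1,\dots,r'_d), \] \[ (r_1,\dots,r_d)\succeq^{(2)}(r'_1,\dots,r'_d)\iff \mathrm{flat}(r_1,\dots,r_d)\succeq\mathrm{flat}(r'_1,\dots,r'_d). \]
   Context: On $[0,\infty)^n$: $(a_1,\dots,a_n)\succ(b_1,\dots,b_n)$ iff there is $l\in\{1,\dots,n\}$ with $a_i\ge b_i$ for all $i<l$ and $a_l\ge1+b_l$; $a\succeq b$ iff $a\succ b$ or $a_i\ge b_i$ for all $i$. Nested orders on $[0,\infty)^{m_1}\times\cdots\times[0,\infty)^{m_d}$: $(r_1,\dots,r_d)\succ^{(2)}(r'_1,\dots,r'_d)$ iff there is $l$ with $r_i\succeq r'_i$ for all $i<l$ and $r_l\succ r'_l$; $r\succeq^{(2)}r'$ iff $r\succ^{(2)}r'$ or $r_i\succeq r'_i$ for all $i$. -}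

module Defs where

open import Level using (Level; _⊔_) renaming (suc to lsuc)
open import Algebra.Bundles using (CommutativeRing)
open import Relation.Binary.Core using (Rel)
open import Relation.Binary.Structures using (IsTotalOrder)
open import Relation.Nullary using (¬_)
open import Data.Product using (Σ; ∃; ∃-syntax; _×_; _,_)
open import Data.Sum using (_⊎_)
open import Data.Nat using (ℕ)
open import Data.Fin using (Fin; zero; suc)
open import Data.Fin.Base as F using ()
open import Data.Vec using (Vec; []; _∷_; lookup; _++_; sum)

-- The real numbers, axiomatised as a (Dedekind-)complete ordered field.
-- Any two such structures are isomorphic, so quantifying over all of them
-- is the same as speaking about ℝ.
record RealField (c ℓ₁ ℓ₂ : Level) : Set (lsuc (c ⊔ ℓ₁ ⊔ ℓ₂)) where
  field
    commutativeRing : CommutativeRing c ℓ₁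
  open CommutativeRing commutativeRing public
  infix 4 _≤_
  field
    _≤_          : Rel Carrier ℓ₂
    isTotalOrder : IsTotalOrder _≈_ _≤_
    0≉1          : ¬ (0# ≈ 1#)
    inverse      : ∀ x → ¬ (x ≈ 0#) → ∃[ y ] (x * y ≈ 1#)
    +-monoˡ-≤    : ∀ {x y} z → x ≤ y → x + z ≤ y + z
    *-nonneg     : ∀ {x y} → 0# ≤ x → 0# ≤ y → 0# ≤ x * y
    complete     : (P : Carrier → Set c) → ∃ P →
                   (∃[ b ] (∀ x → P x → x ≤ b)) →
                   ∃[ s ] ((∀ x → P x → x ≤ s) ×
                           (∀ b → (∀ x → P x → x ≤ b) → s ≤ b))

module Orders {c ℓ₁ ℓ₂} (ℝ : RealField c ℓ₁ ℓ₂) where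
  open RealField ℝ using (Carrier; _≤_; _+_; 0#; 1#)

  Nonneg : ∀ {n} → Vec Carrier n → Set ℓ₂
  Nonneg {n} a = ∀ (i : Fin n) → 0# ≤ lookup a i

  _≻_ : ∀ {n} → Vec Carrier n → Vec Carrier n → Set (ℓ₂)
  _≻_ {n} a b = ∃[ l ] ((∀ (i : Fin n) → i F.< l → lookup b i ≤ lookup a i)
                        × (1# + lookup b l ≤ lookup a l))

  _⪰_ : ∀ {n} → Vec Carrier n → Vec Carrier n → Set ℓ₂
  _⪰_ {n} a b = (a ≻ b) ⊎ (∀ (i : Fin n) → lookup b i ≤ lookup a i)

  Blocks : ∀ {d} → Vec ℕ d → Set c
  Blocks {d} m = (i : Fin d) → Vec Carrier (lookup m i)

  ≻₂ : ∀ {d} (m : Vec ℕ d) → Blocks m → Blocks m → Set ℓ₂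
  ≻₂ {d} m r r' = ∃[ l ] ((∀ (i : Fin d) → i F.< l → r i ⪰ r' i) × (r l ≻ r' l))

  ⪰₂ : ∀ {d} (m : Vec ℕ d) → Blocks m → Blocks m → Set ℓ₂
  ⪰₂ {d} m r r' = ≻₂ m r r' ⊎ (∀ (i : Fin d) → r i ⪰ r' i)

  flat : ∀ {d} (m : Vec ℕ d) → Blocks m → Vec Carrier (sum m)
  flat []      r = []
  flat (k ∷ m) r = r zero ++ flat m (λ i → r (suc i))

-- Both ≻ and ≻⁽²⁾ have the shape "at the first index where the sides differ
-- strictly, the left side wins", and concatenating blocks preserves the order
-- of indices. So a strict win inside block l preceded by blocks that are ⪰
-- becomes a strict win in the flat vector: a preceding block that is ≻ already
-- wins earlier, and one that is merely pointwise ≥ is passed over.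
module Submission where

open import Defs
open import Level using (Level; _⊔_)
open import Data.Nat using (ℕ; _>_; s≤s; z≤n)
open import Data.Fin as F using (Fin; zero; suc)
open import Data.Fin.Properties using (∀-cons)
open import Data.Vec using (Vec; lookup; []; _∷_; _++_)
open import Data.Product using (_×_; _,_; ∃-syntax)
open import Data.Sum using (_⊎_; inj₁; inj₂)
open import Function using (_∘_; case_of_)
open import Function.Bundles using (_⇔_; mk⇔)

-- Both ≻ and ≻₂ unfold definitionally to instances of Lex.
Lex : ∀ {p q n} → (Fin n → Set p) → (Fin n → Set q) → Set (p ⊔ q)
Lex {n = n} P Q = ∃[ l ] ((∀ (i : Fin n) → i F.< l → Q i) × P l)

module _ {p q n} (P : Fin (ℕ.suc n) → Set p) (Q : Fin (ℕ.suc n) → Set q) where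

  Lex-∷⁺ : P zero ⊎ (Q zero × Lex (P ∘ suc) (Q ∘ suc)) → Lex P Q
  Lex-∷⁺ (inj₁ p₀) = zero , (λ _ ()) , p₀
  Lex-∷⁺ (inj₂ (q₀ , l , q , p)) = suc l , before , p
    where
    before : ∀ i → i F.< suc l → Q i
    before zero    _         = q₀
    before (suc i) (s≤s i<l) = q i i<l

  Lex-∷⁻ : Lex P Q → P zero ⊎ (Q zero × Lex (P ∘ suc) (Q ∘ suc))
  Lex-∷⁻ (zero  , _ , p) = inj₁ p
  Lex-∷⁻ (suc l , q , p) = inj₂ (q zero (s≤s z≤n) , l , (λ i → q (suc i) ∘ s≤s) , p)

Lex-mapʳ : ∀ {p q r n} {P : Fin n → Set p} {Q : Fin n → Set q} {R : Fin n → Set r} →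
           (∀ {i} → Q i → R i) → Lex P Q → Lex P R
Lex-mapʳ f (l , q , p) = l , (λ i → f ∘ q i) , p

Lex-first : ∀ {p q n} {P : Fin n → Set p} {Q : Fin n → Set q} →
            (∀ i → P i ⊎ Q i) → Lex P Q ⊎ (∀ i → Q i)
Lex-first {n = ℕ.zero} _ = inj₂ λ ()
Lex-first {n = ℕ.suc _} {P} {Q} h with h zero | Lex-first (h ∘ suc)
... | inj₁ p₀ | _         = inj₁ (Lex-∷⁺ P Q (inj₁ p₀))
... | inj₂ q₀ | inj₁ lex  = inj₁ (Lex-∷⁺ P Q (inj₂ (q₀ , lex)))
... | inj₂ q₀ | inj₂ allQ = inj₂ (∀-cons q₀ allQ)

module _ {c ℓ₁ ℓ₂} (ℝ : RealField c ℓ₁ ℓ₂) where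
  open RealField ℝ using (Carrier; _≤_; _+_; 1#)
  open Orders ℝ

  infix 4 _≥ₚ_
  _≥ₚ_ : ∀ {n} → Vec Carrier n → Vec Carrier n → Set ℓ₂
  _≥ₚ_ {n} a b = ∀ (i : Fin n) → lookup b i ≤ lookup a i

  module _ {x y : Carrier} {n} {a b : Vec Carrier n} where

    ≻-∷⁺ : 1# + y ≤ x ⊎ (y ≤ x × a ≻ b) → (x ∷ a) ≻ (y ∷ b)
    ≻-∷⁺ = Lex-∷⁺ (λ l → 1# + lookup (y ∷ b) l ≤ lookup (x ∷ a) l)
                  (λ i → lookup (y ∷ b) i ≤ lookup (x ∷ a) i)

    ≻-∷⁻ : (x ∷ a) ≻ (y ∷ b) → 1# + y ≤ x ⊎ (y ≤ x × a ≻ b)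
    ≻-∷⁻ = Lex-∷⁻ (λ l → 1# + lookup (y ∷ b) l ≤ lookup (x ∷ a) l)
                  (λ i → lookup (y ∷ b) i ≤ lookup (x ∷ a) i)

  ≥ₚ-++⁺ : ∀ {n k} (a a' : Vec Carrier n) {b b' : Vec Carrier k} →
           a ≥ₚ a' → b ≥ₚ b' → a ++ b ≥ₚ a' ++ b'
  ≥ₚ-++⁺ []      []       _ q = q
  ≥ₚ-++⁺ (_ ∷ a) (_ ∷ a') p q = ∀-cons (p zero) (≥ₚ-++⁺ a a' (p ∘ suc) q)

  ≥ₚ-++⁻ : ∀ {n k} (a a' : Vec Carrier n) {b b' : Vec Carrier k} →
           a ++ b ≥ₚ a' ++ b' → a ≥ₚ a' × b ≥ₚ b'
  ≥ₚ-++⁻ []      []       p = (λ ()) , p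
  ≥ₚ-++⁻ (_ ∷ a) (_ ∷ a') p with ≥ₚ-++⁻ a a' (p ∘ suc)
  ... | pa , pb = ∀-cons (p zero) pa , pb

  ≻-++⁺ : ∀ {n k} (a a' : Vec Carrier n) (b b' : Vec Carrier k) →
          a ≻ a' ⊎ (a ≥ₚ a' × b ≻ b') → (a ++ b) ≻ (a' ++ b')
  ≻-++⁺ []      []       _ _  (inj₂ (_ , g)) = g
  ≻-++⁺ (_ ∷ a) (_ ∷ a') b b' (inj₁ g) with ≻-∷⁻ g
  ... | inj₁ q        = ≻-∷⁺ (inj₁ q)
  ... | inj₂ (p , g') = ≻-∷⁺ (inj₂ (p , ≻-++⁺ a a' b b' (inj₁ g')))
  ≻-++⁺ (_ ∷ a) (_ ∷ a') b b' (inj₂ (p , g)) =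
    ≻-∷⁺ (inj₂ (p zero , ≻-++⁺ a a' b b' (inj₂ (p ∘ suc , g))))

  ≻-++⁻ : ∀ {n k} (a a' : Vec Carrier n) {b b' : Vec Carrier k} →
          (a ++ b) ≻ (a' ++ b') → a ≻ a' ⊎ (a ≥ₚ a' × b ≻ b')
  ≻-++⁻ []      []       g = inj₂ ((λ ()) , g)
  ≻-++⁻ (_ ∷ a) (_ ∷ a') g with ≻-∷⁻ g
  ... | inj₁ q        = inj₁ (≻-∷⁺ (inj₁ q))
  ... | inj₂ (p , g') with ≻-++⁻ a a' g'
  ...   | inj₁ h        = inj₁ (≻-∷⁺ (inj₂ (p , h)))
  ...   | inj₂ (ps , h) = inj₂ (∀-cons p ps , h)

  tailᴮ : ∀ {d k} {m : Vec ℕ d} → Blocks (k ∷ m) → Blocks m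
  tailᴮ r i = r (suc i)

  module _ {d k} {m : Vec ℕ d} (r r' : Blocks (k ∷ m)) where

    ≻₂-∷⁺ : r zero ≻ r' zero ⊎ (r zero ⪰ r' zero × ≻₂ m (tailᴮ r) (tailᴮ r')) → ≻₂ (k ∷ m) r r'
    ≻₂-∷⁺ = Lex-∷⁺ (λ l → r l ≻ r' l) (λ i → r i ⪰ r' i)

    ≻₂-∷⁻ : ≻₂ (k ∷ m) r r' → r zero ≻ r' zero ⊎ (r zero ⪰ r' zero × ≻₂ m (tailᴮ r) (tailᴮ r'))
    ≻₂-∷⁻ = Lex-∷⁻ (λ l → r l ≻ r' l) (λ i → r i ⪰ r' i)

  flat-≥ₚ⁺ : ∀ {d} (m : Vec ℕ d) (r r' : Blocks m) → (∀ i → r i ≥ₚ r' i) → flat m r ≥ₚ flat m r'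
  flat-≥ₚ⁺ (_ ∷ m) r r' p =
    ≥ₚ-++⁺ (r zero) (r' zero) (p zero) (flat-≥ₚ⁺ m (tailᴮ r) (tailᴮ r') (p ∘ suc))

  flat-≥ₚ⁻ : ∀ {d} (m : Vec ℕ d) (r r' : Blocks m) → flat m r ≥ₚ flat m r' → ∀ i → r i ≥ₚ r' i
  flat-≥ₚ⁻ (_ ∷ m) r r' p with ≥ₚ-++⁻ (r zero) (r' zero) p
  ... | p₀ , ps = ∀-cons p₀ (flat-≥ₚ⁻ m (tailᴮ r) (tailᴮ r') ps)

  flat-≻⁺ : ∀ {d} (m : Vec ℕ d) (r r' : Blocks m) → ≻₂ m r r' → flat m r ≻ flat m r'
  flat-≻⁺ (_ ∷ m) r r' g =
    ≻-++⁺ (r zero) (r' zero) (flat m (tailᴮ r)) (flat m (tailᴮ r')) (case ≻₂-∷⁻ r r' g of λ where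
      (inj₁ g₀)             → inj₁ g₀
      (inj₂ (inj₁ g₀ , _))  → inj₁ g₀
      (inj₂ (inj₂ p₀ , gs)) → inj₂ (p₀ , flat-≻⁺ m (tailᴮ r) (tailᴮ r') gs))

  flat-≻⁻ : ∀ {d} (m : Vec ℕ d) (r r' : Blocks m) → flat m r ≻ flat m r' → ≻₂ m r r'
  flat-≻⁻ (_ ∷ m) r r' g with ≻-++⁻ (r zero) (r' zero) g
  ... | inj₁ g₀        = ≻₂-∷⁺ r r' (inj₁ g₀)
  ... | inj₂ (p₀ , gs) = ≻₂-∷⁺ r r' (inj₂ (inj₂ p₀ , flat-≻⁻ m (tailᴮ r) (tailᴮ r') gs))

  ≻₂⇔flat-≻ : ∀ {d} (m : Vec ℕ d) (r r' : Blocks m) → ≻₂ m r r' ⇔ (flat m r ≻ flat m r')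
  ≻₂⇔flat-≻ m r r' = mk⇔ (flat-≻⁺ m r r') (flat-≻⁻ m r r')

  ⪰₂⇔flat-⪰ : ∀ {d} (m : Vec ℕ d) (r r' : Blocks m) → ⪰₂ m r r' ⇔ (flat m r ⪰ flat m r')
  ⪰₂⇔flat-⪰ m r r' = mk⇔ to from
    where
    to : ⪰₂ m r r' → flat m r ⪰ flat m r'
    to (inj₁ g) = inj₁ (flat-≻⁺ m r r' g)
    to (inj₂ ⪰s) with Lex-first ⪰s
    ... | inj₁ g   = inj₁ (flat-≻⁺ m r r' (Lex-mapʳ inj₂ g))
    ... | inj₂ ≥ₚs = inj₂ (flat-≥ₚ⁺ m r r' ≥ₚs)

    from : flat m r ⪰ flat m r' → ⪰₂ m r r'
    from (inj₁ g) = inj₁ (flat-≻⁻ m r r' g)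
    from (inj₂ p) = inj₂ (λ i → inj₂ (flat-≥ₚ⁻ m r r' p i))

-- The positivity of the mᵢ and the nonnegativity of the entries are not needed.
lemma5p8 : ∀ {c ℓ₁ ℓ₂ : Level} (ℝ : RealField c ℓ₁ ℓ₂) → let open Orders ℝ in
    ∀ (d : ℕ) (m : Vec ℕ d) → (∀ (i : Fin d) → lookup m i > 0) →
    ∀ (r r' : Blocks m) →
    (∀ (i : Fin d) → Nonneg (r i)) → (∀ (i : Fin d) → Nonneg (r' i)) →
    (≻₂ m r r' ⇔ (flat m r ≻ flat m r')) × (⪰₂ m r r' ⇔ (flat m r ⪰ flat m r'))
lemma5p8 ℝ d m _ r r' _ _ = ≻₂⇔flat-≻ ℝ m r r' , ⪰₂⇔flat-⪰ ℝ m r r'
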